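{- The prism graphs $\Pi_3$ and $\Pi_5$ are equitably 3-choosable.
   Context: The prism graph $\Pi_n$ is $C_n \square K_2$: vertices $u_1,\dots,u_n,v_1,\dots,v_n$, edges $u_iu_{i+1}$, $v_iv_{i+1}$ (indices mod $n$) and $u_iv_i$. A graph $G$ is equitably $k$-choosable if for every list assignment $L$ with $|L(v)|=k$ for all vertices $v$, there is a proper coloring $c$ with $c(v)\in L(v)$ for all $v$ in which each color is used on at most $\lceil |V(G)|/k\rceil$ vertices. -}

module Defs where

open import Data.Nat using (ℕ; zero; suc; _+_; _∸_; _≤_; _≟_; NonZero)
open import Data.Nat.DivMod using (_/_)
open import Data.Fin using (Fin; toℕ; splitAt)
open import Data.List using (List; length; filter; allFin)
open import Data.List.Membership.Propositional using (_∈_)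
open import Data.List.Relation.Unary.Unique.Propositional using (Unique)
open import Data.Sum using (_⊎_; inj₁; inj₂)
open import Data.Product using (Σ; _×_)
open import Relation.Binary.PropositionalEquality using (_≡_; _≢_)

record Graph : Set₁ where
  field
    size : ℕ
    Adj  : Fin size → Fin size → Set
open Graph public

CycAdj : (n : ℕ) → Fin n → Fin n → Set
CycAdj n i j =
  (toℕ j ≡ suc (toℕ i) ⊎ (suc (toℕ i) ≡ n × toℕ j ≡ 0))
  ⊎ (toℕ i ≡ suc (toℕ j) ⊎ (suc (toℕ j) ≡ n × toℕ i ≡ 0))

-- Adjacency of the prism on (Fin n ⊎ Fin n): inj₁ i is u_{i+1}, inj₂ i is v_{i+1}.
PrismAdj' : (n : ℕ) → Fin n ⊎ Fin n → Fin n ⊎ Fin n → Set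
PrismAdj' n (inj₁ i) (inj₁ j) = CycAdj n i j
PrismAdj' n (inj₂ i) (inj₂ j) = CycAdj n i j
PrismAdj' n (inj₁ i) (inj₂ j) = i ≡ j
PrismAdj' n (inj₂ i) (inj₁ j) = i ≡ j

-- The prism graph Π_n = C_n □ K_2 on 2n vertices: vertex x < n is u_{x+1}, vertex n+x is v_{x+1}.
Prism : ℕ → Graph
Prism n = record
  { size = n + n
  ; Adj  = λ x y → PrismAdj' n (splitAt n x) (splitAt n y)
  }

⌈_/_⌉ : ℕ → (k : ℕ) → .{{NonZero k}} → ℕ
⌈ m / k ⌉ = (m + k ∸ 1) / k

IsKListAssignment : (G : Graph) → ℕ → (Fin (size G) → List ℕ) → Set
IsKListAssignment G k L = ∀ v → length (L v) ≡ k × Unique (L v)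

colourClassSize : (G : Graph) → (Fin (size G) → ℕ) → ℕ → ℕ
colourClassSize G c a = length (filter (λ v → c v ≟ a) (allFin (size G)))

IsEquitableLColouring : (G : Graph) (k : ℕ) .{{_ : NonZero k}} →
  (Fin (size G) → List ℕ) → (Fin (size G) → ℕ) → Set
IsEquitableLColouring G k L c =
  (∀ v → c v ∈ L v)
  × (∀ u v → Adj G u v → c u ≢ c v)
  × (∀ a → colourClassSize G c a ≤ ⌈ size G / k ⌉)

EquitablyChoosable : (G : Graph) (k : ℕ) .{{_ : NonZero k}} → Set
EquitablyChoosable G k =
  ∀ (L : Fin (size G) → List ℕ) → IsKListAssignment G k L →
  Σ (Fin (size G) → ℕ) (λ c → IsEquitableLColouring G k L c)

-- A proper colouring of Π_n meets each of its two n-cycles in an independent set, which has at most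
-- ⌊n/2⌋ vertices. Hence every colour class of a proper colouring of Π_3 (resp. Π_5) has at most
-- 2 = ⌈6/3⌉ (resp. 4 = ⌈10/3⌉) vertices, equitability comes for free, and it suffices that Π_3 and
-- Π_5 are 3-choosable. Let L be a 3-list assignment. If L x ⊆ L y along every edge xy then, the graph
-- being connected, every list contains the list L r of a fixed vertex r, and any proper 3-colouring
-- read through L r is an L-colouring. Otherwise some colour a ∈ L x is missing from L y for an edge
-- xy. Colour x with a and then the other vertices greedily, farther from y in Π_n − x first: when a
-- vertex other than y is reached one of its three neighbours is still uncoloured, and y has x as a
-- coloured neighbour whose colour is not in L y, so at most two colours are ever forbidden. The
-- connectivity and the greedy orders are checked by computation.
module Submission where

open import Defs
open import Data.Empty using (⊥)
open import Data.Fin using (Fin; zero; suc; toℕ; splitAt; _↑ˡ_; _↑ʳ_; #_)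
import Data.Fin.Properties as Fin
open import Data.List using (List; []; _∷_; _++_; length; filter; map; concat; take; lookup; allFin)
open import Data.List.Properties
  using (length-map; filter-reject; filter-notAll; filter-++; length-++; length-filter)
open import Data.List.Membership.Propositional using (_∈_; _∉_)
open import Data.List.Membership.Propositional.Properties using (∈-filter⁺; ∈-lookup; ∈-map⁺)
open import Data.List.Relation.Binary.Permutation.Propositional using (↭-sym)
open import Data.List.Relation.Binary.Permutation.Propositional.Properties using (shift)
open import Data.List.Relation.Binary.Subset.Propositional using (_⊆_)
open import Data.List.Relation.Binary.Subset.Propositional.Properties using (⊆-reflexive-↭; ⊆-refl)
open import Data.List.Relation.Unary.All as All using (All; []; _∷_)
open import Data.List.Relation.Unary.AllPairs using ([]; _∷_)
open import Data.List.Relation.Unary.Any as Any using (Any; here; there)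
open import Data.List.Relation.Unary.Linked as Linked using (Linked)
open import Data.List.Relation.Unary.Unique.Propositional using (Unique)
open import Data.Nat using (ℕ; NonZero; nonZero; zero; suc; _+_; _*_; _≤_; _<_; z≤n; s≤s; _≟_; _<?_)
open import Data.Nat.DivMod using (_/_; /-monoˡ-≤; m*n/n≡m)
open import Data.Nat.ListAction using (sum)
open import Data.Nat.Properties
  using (≤-refl; ≤-pred; 1+n≢n; m≤n⇒m≤1+n; <⇒≱; +-comm; +-identityʳ; +-mono-≤; module ≤-Reasoning)
import Data.Product as Product
open import Data.Product using (Σ; ∃-syntax; _×_; _,_; proj₁; proj₂)
import Data.Sum as Sum
open import Data.Sum using (_⊎_; inj₁; inj₂; [_,_]′; fromInj₁)
open import Data.Unit using (⊤; tt)
import Data.Vec as Vec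
open Vec using (_∷_; [])
open import Data.Vec.Functional using (updateAt)
open import Data.Vec.Functional.Properties using (updateAt-updates; updateAt-minimal)
open import Function using (_∘_; const)
open import Function.Definitions using (Injective)
open import Level using (0ℓ)
import Relation.Binary as B
open import Relation.Binary using (Rel; DecidableEquality; Symmetric)
open import Relation.Binary.PropositionalEquality
  using (_≡_; _≢_; refl; sym; trans; cong; subst; subst₂)
open import Relation.Nullary
  using (¬_; Dec; yes; no; contradiction; ¬?; _×-dec_; _⊎-dec_; _→-dec_)
open import Relation.Nullary.Decidable using (True; toWitness; from-yes)
open import Relation.Unary using (Pred; Decidable)

module _ {A : Set} (_≟_ : DecidableEquality A) where

  open import Data.List.Membership.DecPropositional _≟_ using (_∈?_)

  ⊆-or-∉ : (xs ys : List A) → xs ⊆ ys ⊎ ∃[ a ] a ∈ xs × a ∉ ys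
  ⊆-or-∉ []       ys = inj₁ λ ()
  ⊆-or-∉ (x ∷ xs) ys with x ∈? ys | ⊆-or-∉ xs ys
  ... | no x∉ys  | _                      = inj₂ (x , here refl , x∉ys)
  ... | yes _    | inj₂ (a , a∈xs , a∉ys) = inj₂ (a , there a∈xs , a∉ys)
  ... | yes x∈ys | inj₁ xs⊆ys             = inj₁ λ { (here refl) → x∈ys ; (there a∈xs) → xs⊆ys a∈xs }

  Unique-⊆⇒length-≤ : ∀ {xs ys} → Unique xs → xs ⊆ ys → length xs ≤ length ys
  Unique-⊆⇒length-≤ []                                  _       = z≤n
  Unique-⊆⇒length-≤ {x ∷ xs} {ys} (x≢xs ∷ xs-unique) x∷xs⊆ys = begin-strict
    length xs                        ≤⟨ Unique-⊆⇒length-≤ xs-unique xs⊆ys-x ⟩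
    length (filter (¬? ∘ (x ≟_)) ys) <⟨ filter-notAll (¬? ∘ (x ≟_)) ys x∈ys ⟩
    length ys                        ∎
    where
    open ≤-Reasoning
    x∈ys : Any (λ y → ¬ ¬ x ≡ y) ys
    x∈ys = Any.map (λ x≡y x≢y → x≢y x≡y) (x∷xs⊆ys (here refl))
    xs⊆ys-x : xs ⊆ filter (¬? ∘ (x ≟_)) ys
    xs⊆ys-x a∈xs = ∈-filter⁺ (¬? ∘ (x ≟_)) (x∷xs⊆ys (there a∈xs)) (All.lookup x≢xs a∈xs)

  Unique-longer⇒∃∉ : ∀ {xs ys} → Unique xs → length ys < length xs → ∃[ a ] a ∈ xs × a ∉ ys
  Unique-longer⇒∃∉ {xs} {ys} xs-unique ys<xs with ⊆-or-∉ xs ys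
  ... | inj₁ xs⊆ys = contradiction (Unique-⊆⇒length-≤ xs-unique xs⊆ys) (<⇒≱ ys<xs)
  ... | inj₂ fresh = fresh

lookup-injective : ∀ {A : Set} {xs : List A} → Unique xs → Injective _≡_ _≡_ (lookup xs)
lookup-injective (_    ∷ _)         {zero}  {zero}  _  = refl
lookup-injective (x≢xs ∷ _)         {zero}  {suc j} eq = contradiction eq (All.lookup x≢xs (∈-lookup j))
lookup-injective (x≢xs ∷ _)         {suc i} {zero}  eq = contradiction (sym eq) (All.lookup x≢xs (∈-lookup i))
lookup-injective (_    ∷ xs-unique) {suc i} {suc j} eq = cong suc (lookup-injective xs-unique eq)

enumerate : ∀ {k} (xs : List ℕ) → length xs ≡ k → Unique xs →
  Σ (Fin k → ℕ) λ g → (∀ i → g i ∈ xs) × Injective _≡_ _≡_ g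
enumerate xs refl xs-unique = lookup xs , ∈-lookup , lookup-injective xs-unique

*2≤⇒≤/2 : ∀ {m n} → m * 2 ≤ n → m ≤ n / 2
*2≤⇒≤/2 {m} {n} m*2≤n = subst (_≤ n / 2) (m*n/n≡m m 2) (/-monoˡ-≤ 2 m*2≤n)

Cyclic : ∀ {A : Set} → Rel A 0ℓ → List A → Set
Cyclic R xs = Linked R (xs ++ take 1 xs)

cyclic? : ∀ {A : Set} {R : Rel A 0ℓ} → B.Decidable R → Decidable (Cyclic R)
cyclic? R? xs = Linked.linked? R? (xs ++ take 1 xs)

module _ {A : Set} {P : Pred A 0ℓ} (P? : Decidable P) where

  count : List A → ℕ
  count xs = length (filter P? xs)

  count-++ : ∀ xs ys → count (xs ++ ys) ≡ count xs + count ys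
  count-++ xs ys = trans (cong length (filter-++ P? xs ys)) (length-++ (filter P? xs))

  module _ {R : Rel A 0ℓ} (independent : ∀ {u v} → R u v → P u → ¬ P v) where

    -- Counting the end point z once is what makes the bound sharp enough for closed walks.
    path-count-≤ : ∀ xs {z} → Linked R (xs ++ z ∷ []) → count xs * 2 + count (z ∷ []) ≤ suc (length xs)
    path-count-≤ []           _  = length-filter P? (_ ∷ [])
    path-count-≤ (x ∷ xs)     lk with P? x
    path-count-≤ (x ∷ xs)     lk | no _ = m≤n⇒m≤1+n (path-count-≤ xs (Linked.tail lk))
    path-count-≤ (x ∷ [])     lk | yes px
      rewrite filter-reject P? {xs = []} (independent (Linked.head lk) px) = ≤-refl
    path-count-≤ (x ∷ y ∷ ys) lk | yes px with P? y
    ... | yes py = contradiction py (independent (Linked.head lk) px)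
    ... | no _   = s≤s (s≤s (path-count-≤ ys (Linked.tail (Linked.tail lk))))

    cycle-count*2-≤ : ∀ {x xs} → Cyclic R (x ∷ xs) → count (x ∷ xs) * 2 ≤ length (x ∷ xs)
    cycle-count*2-≤ {x} {xs} lk with P? x | path-count-≤ (x ∷ xs) lk | path-count-≤ xs (Linked.tail lk)
    ... | yes _ | bound | _     = ≤-pred (subst (_≤ suc (length (x ∷ xs))) (+-comm _ 1) bound)
    ... | no _  | _     | bound = subst (_≤ length (x ∷ xs)) (+-identityʳ _) bound

    cycle-count-≤ : ∀ {xs} → Cyclic R xs → count xs ≤ length xs / 2
    cycle-count-≤ {[]}    _  = z≤n
    cycle-count-≤ {_ ∷ _} lk = *2≤⇒≤/2 (cycle-count*2-≤ lk)

    cycleCover-count-≤ : ∀ {cs} → All (Cyclic R) cs → count (concat cs) ≤ sum (map (λ C → length C / 2) cs)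
    cycleCover-count-≤ []                     = z≤n
    cycleCover-count-≤ {C ∷ cs} (cyc ∷ cycs) = begin
      count (C ++ concat cs)      ≡⟨ count-++ C (concat cs) ⟩
      count C + count (concat cs) ≤⟨ +-mono-≤ (cycle-count-≤ {C} cyc) (cycleCover-count-≤ cycs) ⟩
      length C / 2 + sum (map (λ C → length C / 2) cs) ∎
      where open ≤-Reasoning

Rooted : ∀ {A : Set} → Rel A 0ℓ → A → List A → Set
Rooted R r []               = ⊥
Rooted R r (w ∷ [])         = w ≡ r
Rooted R r (w ∷ ws@(_ ∷ _)) = Any (R w) ws × Rooted R r ws

rooted? : ∀ {A : Set} → DecidableEquality A → {R : Rel A 0ℓ} → B.Decidable R → ∀ r ws → Dec (Rooted R r ws)
rooted? _≟_ R? r []               = no λ ()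
rooted? _≟_ R? r (w ∷ [])         = w ≟ r
rooted? _≟_ R? r (w ∷ ws@(_ ∷ _)) = Any.any? (R? w) ws ×-dec rooted? _≟_ R? r ws

Rooted⇒All : ∀ {A : Set} {R : Rel A 0ℓ} {P : Pred A 0ℓ} {r} →
  (∀ {u v} → R u v → P v → P u) → P r → ∀ {ws} → Rooted R r ws → All P ws
Rooted⇒All step Pr {_ ∷ []}         refl                = Pr ∷ []
Rooted⇒All step Pr {_ ∷ ws@(_ ∷ _)} (w→ws , ws-rooted) with Pws ← Rooted⇒All step Pr ws-rooted =
  let Pv , R[w,v] = All.lookupAny Pws w→ws in step R[w,v] Pv ∷ Pws

Proper : (G : Graph) → (Fin (size G) → ℕ) → Set
Proper G c = ∀ u v → Adj G u v → c u ≢ c v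

IsLColouring : (G : Graph) → (Fin (size G) → List ℕ) → (Fin (size G) → ℕ) → Set
IsLColouring G L c = (∀ v → c v ∈ L v) × Proper G c

Choosable : Graph → ℕ → Set
Choosable G k = ∀ L → IsKListAssignment G k L → Σ (Fin (size G) → ℕ) (IsLColouring G L)

colourClassSize-≤ : ∀ G {c} → Proper G c → (cs : List (List (Fin (size G)))) →
  concat cs ≡ allFin (size G) → All (Cyclic (Adj G)) cs →
  ∀ a → colourClassSize G c a ≤ sum (map (λ C → length C / 2) cs)
colourClassSize-≤ G {c} proper cs cover cycles a rewrite sym cover =
  cycleCover-count-≤ (λ v → c v ≟ a) (λ uv u≡a v≡a → proper _ _ uv (trans u≡a (sym v≡a))) cycles

choosable⇒equitablyChoosable : ∀ {G k} .{{_ : NonZero k}} → Choosable G k →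
  (∀ c → Proper G c → ∀ a → colourClassSize G c a ≤ ⌈ size G / k ⌉) → EquitablyChoosable G k
choosable⇒equitablyChoosable choose small L L-ok with choose L L-ok
... | c , c∈L , proper = c , c∈L , proper , small c proper

module Greedy {N : ℕ} {R : Rel (Fin N) 0ℓ} (R? : B.Decidable R) where

  open import Data.List.Membership.DecPropositional (Fin._≟_ {N}) using (_∉?_)

  earlierNeighbours : List (Fin N) → Fin N → List (Fin N)
  earlierNeighbours done w = filter (λ u → R? u w) done

  GreedyOrder : ℕ → List (Fin N) → List (Fin N) → Set
  GreedyOrder k done []       = ⊤
  GreedyOrder k done (w ∷ ws) =
    w ∉ done × length (earlierNeighbours done w) < k × GreedyOrder k (w ∷ done) ws

  greedyOrder? : ∀ k done ws → Dec (GreedyOrder k done ws)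
  greedyOrder? k done []       = yes tt
  greedyOrder? k done (w ∷ ws) =
    w ∉? done ×-dec length (earlierNeighbours done w) <? k ×-dec greedyOrder? k (w ∷ done) ws

  module Colouring (R-sym : Symmetric R) (R-irrefl : ∀ {v} → ¬ R v v)
                   {k} (L : Fin N → List ℕ) (L-ok : ∀ v → length (L v) ≡ k × Unique (L v)) where

    ProperOn : List (Fin N) → (Fin N → ℕ) → Set
    ProperOn vs c = (∀ {v} → v ∈ vs → c v ∈ L v) × (∀ {u v} → u ∈ vs → v ∈ vs → R u v → c u ≢ c v)

    ProperOn-⊆ : ∀ {us vs c} → us ⊆ vs → ProperOn vs c → ProperOn us c
    ProperOn-⊆ us⊆vs (c∈L , proper) = c∈L ∘ us⊆vs , λ u∈us v∈us → proper (us⊆vs u∈us) (us⊆vs v∈us)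

    Extends : List (Fin N) → (Fin N → ℕ) → (Fin N → ℕ) → Set
    Extends done c c′ = ∀ {v} → v ∈ done → c′ v ≡ c v

    colour-next : ∀ {w done c} → w ∉ done → length (earlierNeighbours done w) < k → ProperOn done c →
      ∃[ c′ ] ProperOn (w ∷ done) c′ × Extends done c c′
    colour-next {w} {done} {c} w∉done few (c∈L , proper) = c′ , (c′∈L , proper′) , unchanged
      where
      forbidden : List ℕ
      forbidden = map c (earlierNeighbours done w)

      fresh : ∃[ a ] a ∈ L w × a ∉ forbidden
      fresh = Unique-longer⇒∃∉ _≟_ (proj₂ (L-ok w))
        (subst₂ _<_ (sym (length-map c (earlierNeighbours done w))) (sym (proj₁ (L-ok w))) few)

      a : ℕ
      a = proj₁ fresh

      c′ : Fin N → ℕ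
      c′ = updateAt c w (const a)

      c′w≡a : c′ w ≡ a
      c′w≡a = updateAt-updates w {const a} c

      unchanged : Extends done c c′
      unchanged v∈done = updateAt-minimal _ w {const a} c λ { refl → w∉done v∈done }

      c′∈L : ∀ {v} → v ∈ w ∷ done → c′ v ∈ L v
      c′∈L (here refl)    = subst (_∈ L w) (sym c′w≡a) (proj₁ (proj₂ fresh))
      c′∈L (there v∈done) = subst (_∈ L _) (sym (unchanged v∈done)) (c∈L v∈done)

      avoids-earlier : ∀ {v} → v ∈ done → R v w → c′ v ≢ c′ w
      avoids-earlier v∈done vw c′v≡c′w = proj₂ (proj₂ fresh)
        (subst (_∈ forbidden) (trans (sym (unchanged v∈done)) (trans c′v≡c′w c′w≡a))
          (∈-map⁺ c (∈-filter⁺ (λ u → R? u w) v∈done vw)))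

      proper′ : ∀ {u v} → u ∈ w ∷ done → v ∈ w ∷ done → R u v → c′ u ≢ c′ v
      proper′ (here refl)    (here refl)    uv = contradiction uv R-irrefl
      proper′ (here refl)    (there v∈done) uv = avoids-earlier v∈done (R-sym uv) ∘ sym
      proper′ (there u∈done) (here refl)    uv = avoids-earlier u∈done uv
      proper′ (there u∈done) (there v∈done) uv c′u≡c′v =
        proper u∈done v∈done uv (trans (sym (unchanged u∈done)) (trans c′u≡c′v (unchanged v∈done)))

    greedy-extend : ∀ ws {done c} → GreedyOrder k done ws → ProperOn done c →
      ∃[ c′ ] ProperOn (ws ++ done) c′ × Extends done c c′
    greedy-extend []       _                      proper = _ , proper , λ _ → refl
    greedy-extend (w ∷ ws) {done} (w∉done , few , order) proper
      with c₁ , proper₁ , unchanged₁ ← colour-next w∉done few proper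
      with c′ , proper′ , unchanged′ ← greedy-extend ws order proper₁ =
      c′ , ProperOn-⊆ (⊆-reflexive-↭ (↭-sym (shift w ws done))) proper′ ,
      λ v∈done → trans (unchanged′ (there v∈done)) (unchanged₁ v∈done)

module Choosability (G : Graph) (adj? : B.Decidable (Adj G))
                    (adj-sym : Symmetric (Adj G)) (adj-irrefl : ∀ {v} → ¬ Adj G v v) where

  open import Data.List.Membership.DecPropositional (Fin._≟_ {size G}) using (_∈?_; _∉?_)

  V : Set
  V = Fin (size G)

  IsEdge : V → V → Rel V 0ℓ
  IsEdge x y u v = (u ≡ x × v ≡ y) ⊎ (u ≡ y × v ≡ x)

  isEdge? : ∀ x y → B.Decidable (IsEdge x y)
  isEdge? x y u v = (u Fin.≟ x ×-dec v Fin.≟ y) ⊎-dec (u Fin.≟ y ×-dec v Fin.≟ x)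

  AdjWithout : V → V → Rel V 0ℓ
  AdjWithout x y u v = Adj G u v × ¬ IsEdge x y u v

  adjWithout? : ∀ x y → B.Decidable (AdjWithout x y)
  adjWithout? x y u v = adj? u v ×-dec ¬? (isEdge? x y u v)

  adjWithout-sym : ∀ {x y} → Symmetric (AdjWithout x y)
  adjWithout-sym (uv , ¬xy) = adj-sym uv , ¬xy ∘ [ inj₂ ∘ Product.swap , inj₁ ∘ Product.swap ]′

  Connected : Set
  Connected = ∃[ r ] ∃[ ws ] Rooted (Adj G) r ws × (∀ v → v ∈ ws)

  EdgeOrder : ℕ → V → V → Set
  EdgeOrder k x y =
    ∃[ ws ] Greedy.GreedyOrder (adjWithout? x y) k (x ∷ []) ws × (∀ v → v ∈ ws ++ x ∷ [])

  module _ {k} (L : V → List ℕ) (L-ok : IsKListAssignment G k L) where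

    module _ {x y : V} where
      open Greedy (adjWithout? x y)
      open Colouring adjWithout-sym (adj-irrefl ∘ proj₁) L L-ok

      precolour : ∀ {a} → a ∈ L x → ProperOn (x ∷ []) (const a)
      precolour a∈Lx = (λ { (here refl) → a∈Lx }) , λ { (here refl) (here refl) xx _ → adj-irrefl (proj₁ xx) }

      colouring-from-edge : ∀ {a} → Adj G x y → a ∈ L x → a ∉ L y → EdgeOrder k x y →
        Σ (V → ℕ) (IsLColouring G L)
      colouring-from-edge {a} xy a∈Lx a∉Ly (ws , order , covers)
        with c , (c∈L , properOn) , unchanged ← greedy-extend ws order (precolour a∈Lx) =
        c , (λ v → c∈L (covers v)) , proper
        where
        cx≢cy : c x ≢ c y
        cx≢cy cx≡cy = a∉Ly (subst (_∈ L y) (trans (sym cx≡cy) (unchanged (here refl))) (c∈L (covers y)))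

        proper : Proper G c
        proper u v uv with isEdge? x y u v
        ... | no ¬xy                   = properOn (covers u) (covers v) (uv , ¬xy)
        ... | yes (inj₁ (refl , refl)) = cx≢cy
        ... | yes (inj₂ (refl , refl)) = cx≢cy ∘ sym

    colouring-from-lists : (f : V → Fin k) → (∀ u v → Adj G u v → f u ≢ f v) → Connected →
      (∀ x y → Adj G x y → L x ⊆ L y) → Σ (V → ℕ) (IsLColouring G L)
    colouring-from-lists f f-proper (r , ws , rooted , covers) lists-⊆
      with g , g∈Lr , g-injective ← enumerate (L r) (proj₁ (L-ok r)) (proj₂ (L-ok r)) =
      g ∘ f , (λ v → All.lookup Lr⊆ (covers v) (g∈Lr (f v))) , λ u v uv → f-proper u v uv ∘ g-injective
      where
      Lr⊆ : All (λ v → L r ⊆ L v) ws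
      Lr⊆ = Rooted⇒All {P = λ v → L r ⊆ L v}
        (λ uv Lr⊆Lv a∈Lr → lists-⊆ _ _ (adj-sym uv) (Lr⊆Lv a∈Lr)) ⊆-refl rooted

    some-colour-leaves? : ∀ x y → Dec (Adj G x y × ∃[ a ] a ∈ L x × a ∉ L y)
    some-colour-leaves? x y with adj? x y | ⊆-or-∉ _≟_ (L x) (L y)
    ... | no ¬xy | _           = no (¬xy ∘ proj₁)
    ... | yes xy | inj₂ leaves = yes (xy , leaves)
    ... | yes _  | inj₁ Lx⊆Ly  = no λ (_ , _ , a∈Lx , a∉Ly) → a∉Ly (Lx⊆Ly a∈Lx)

    lists-⊆-or-colour-leaves : (∀ x y → Adj G x y → L x ⊆ L y)
                             ⊎ ∃[ x ] ∃[ y ] Adj G x y × ∃[ a ] a ∈ L x × a ∉ L y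
    lists-⊆-or-colour-leaves with Fin.any? (λ x → Fin.any? (some-colour-leaves? x))
    ... | yes (x , y , leaves) = inj₂ (x , y , leaves)
    ... | no none              = inj₁ λ x y xy →
      fromInj₁ (λ leaves → contradiction (x , y , xy , leaves) none) (⊆-or-∉ _≟_ (L x) (L y))

  choosable : ∀ {k} (f : V → Fin k) → (∀ u v → Adj G u v → f u ≢ f v) → Connected →
    (∀ x y → Adj G x y → EdgeOrder k x y) → Choosable G k
  choosable f f-proper connected orders L L-ok with lists-⊆-or-colour-leaves L L-ok
  ... | inj₁ lists-⊆                        = colouring-from-lists L L-ok f f-proper connected lists-⊆
  ... | inj₂ (x , y , xy , _ , a∈Lx , a∉Ly) = colouring-from-edge L L-ok xy a∈Lx a∉Ly (orders x y xy)

  -- Breadth-first search: the vertices outside visited reachable from frontier, farthest first.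
  explore : ℕ → (visited frontier : List V) → List V
  explore zero    _       _        = []
  explore (suc n) visited frontier = explore n (next ++ visited) next ++ next
    where
    next : List V
    next = filter (λ v → v ∉? visited ×-dec Any.any? (λ u → adj? u v) frontier) (allFin (size G))

  spanningOrder : V → List V
  spanningOrder r = explore (size G) (r ∷ []) (r ∷ []) ++ r ∷ []

  -- Marking x as visited makes the search run in G − x.
  edgeOrder : V → V → List V
  edgeOrder x y = explore (size G) (y ∷ x ∷ []) (y ∷ []) ++ y ∷ []

  isColouring? : ∀ {k} (f : V → Fin k) → Dec (∀ u v → Adj G u v → f u ≢ f v)
  isColouring? f = Fin.all? λ u → Fin.all? λ v → adj? u v →-dec ¬? (f u Fin.≟ f v)

  spanningOrder? : ∀ r → Dec (Rooted (Adj G) r (spanningOrder r) × (∀ v → v ∈ spanningOrder r))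
  spanningOrder? r = rooted? Fin._≟_ adj? r (spanningOrder r) ×-dec Fin.all? (_∈? spanningOrder r)

  edgeOrders? : ∀ k → Dec (∀ x y → Adj G x y →
    Greedy.GreedyOrder (adjWithout? x y) k (x ∷ []) (edgeOrder x y) × (∀ v → v ∈ edgeOrder x y ++ x ∷ []))
  edgeOrders? k = Fin.all? λ x → Fin.all? λ y → adj? x y →-dec
    (Greedy.greedyOrder? (adjWithout? x y) k (x ∷ []) (edgeOrder x y)
     ×-dec Fin.all? (_∈? edgeOrder x y ++ x ∷ []))

  choosable-by-search : ∀ {k} (f : V → Fin k) r →
    True (isColouring? f) → True (spanningOrder? r) → True (edgeOrders? k) → Choosable G k
  choosable-by-search f r proper spanning orders =
    choosable f (toWitness proper) (r , _ , toWitness spanning) λ x y xy → _ , toWitness orders x y xy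

cycAdj? : ∀ n → B.Decidable (CycAdj n)
cycAdj? n i j = (toℕ j ≟ suc (toℕ i) ⊎-dec suc (toℕ i) ≟ n ×-dec toℕ j ≟ 0)
         ⊎-dec (toℕ i ≟ suc (toℕ j) ⊎-dec suc (toℕ j) ≟ n ×-dec toℕ i ≟ 0)

prismAdj′? : ∀ n → B.Decidable (PrismAdj' n)
prismAdj′? n (inj₁ i) (inj₁ j) = cycAdj? n i j
prismAdj′? n (inj₂ i) (inj₂ j) = cycAdj? n i j
prismAdj′? n (inj₁ i) (inj₂ j) = i Fin.≟ j
prismAdj′? n (inj₂ i) (inj₁ j) = i Fin.≟ j

prismAdj? : ∀ n → B.Decidable (Adj (Prism n))
prismAdj? n x y = prismAdj′? n (splitAt n x) (splitAt n y)

prismAdj′-sym : ∀ {n} → Symmetric (PrismAdj' n)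
prismAdj′-sym {x = inj₁ _} {inj₁ _} = Sum.swap
prismAdj′-sym {x = inj₂ _} {inj₂ _} = Sum.swap
prismAdj′-sym {x = inj₁ _} {inj₂ _} = sym
prismAdj′-sym {x = inj₂ _} {inj₁ _} = sym

prism-sym : ∀ {n} → Symmetric (Adj (Prism n))
prism-sym {n} {x} {y} = prismAdj′-sym {n} {splitAt n x} {splitAt n y}

cycAdj-irrefl : ∀ {n} → n ≢ 1 → ∀ {i} → ¬ CycAdj n i i
cycAdj-irrefl n≢1 (inj₁ (inj₁ i≡1+i))        = 1+n≢n (sym i≡1+i)
cycAdj-irrefl n≢1 (inj₁ (inj₂ (1+i≡n , i≡0))) = n≢1 (trans (sym 1+i≡n) (cong suc i≡0))
cycAdj-irrefl n≢1 (inj₂ (inj₁ i≡1+i))        = 1+n≢n (sym i≡1+i)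
cycAdj-irrefl n≢1 (inj₂ (inj₂ (1+i≡n , i≡0))) = n≢1 (trans (sym 1+i≡n) (cong suc i≡0))

prism-irrefl : ∀ {n} → n ≢ 1 → ∀ {v} → ¬ Adj (Prism n) v v
prism-irrefl {n} n≢1 {v} with splitAt n v
... | inj₁ _ = cycAdj-irrefl n≢1
... | inj₂ _ = cycAdj-irrefl n≢1

prismCycles : ∀ n → List (List (Fin (n + n)))
prismCycles n = map (_↑ˡ n) (allFin n) ∷ map (n ↑ʳ_) (allFin n) ∷ []

module PrismChoosability (n : ℕ) (n≢1 : n ≢ 1) =
  Choosability (Prism n) (prismAdj? n) prism-sym (prism-irrefl n≢1)

-- u_i ↦ a_i and v_i ↦ a_i + 1 mod 3, for a proper 3-colouring a of the cycle C_n.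
prism3-colouring : Fin 6 → Fin 3
prism3-colouring = Vec.lookup (# 0 ∷ # 1 ∷ # 2 ∷ # 1 ∷ # 2 ∷ # 0 ∷ [])

prism5-colouring : Fin 10 → Fin 3
prism5-colouring = Vec.lookup (# 0 ∷ # 1 ∷ # 0 ∷ # 1 ∷ # 2 ∷ # 1 ∷ # 2 ∷ # 1 ∷ # 2 ∷ # 0 ∷ [])

prism3-choosable : Choosable (Prism 3) 3
prism3-choosable = PrismChoosability.choosable-by-search 3 (λ ()) prism3-colouring zero _ _ _

prism5-choosable : Choosable (Prism 5) 3
prism5-choosable = PrismChoosability.choosable-by-search 5 (λ ()) prism5-colouring zero _ _ _

prism3-colourClassSize-≤ : ∀ c → Proper (Prism 3) c → ∀ a → colourClassSize (Prism 3) c a ≤ ⌈ 6 / 3 ⌉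
prism3-colourClassSize-≤ c proper = colourClassSize-≤ (Prism 3) proper (prismCycles 3) refl
  (from-yes (All.all? (cyclic? (prismAdj? 3)) (prismCycles 3)))

prism5-colourClassSize-≤ : ∀ c → Proper (Prism 5) c → ∀ a → colourClassSize (Prism 5) c a ≤ ⌈ 10 / 3 ⌉
prism5-colourClassSize-≤ c proper = colourClassSize-≤ (Prism 5) proper (prismCycles 5) refl
  (from-yes (All.all? (cyclic? (prismAdj? 5)) (prismCycles 5)))

lemma3p1 : EquitablyChoosable (Prism 3) 3 × EquitablyChoosable (Prism 5) 3
lemma3p1 = choosable⇒equitablyChoosable prism3-choosable prism3-colourClassSize-≤
         , choosable⇒equitablyChoosable prism5-choosable prism5-colourClassSize-≤
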